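{- Let $\Gamma$ be a strongly regular Neumaier graph with parameters $(n,k,\lambda,\mu;a,c)$. Then $\Gamma$ has integer eigenvalues $k$, $c-a-1$ and $-\mu/a$ (these being its eigenvalues).
   Context: All graphs are finite, undirected and simple; eigenvalues are those of the adjacency matrix. A $k$-regular graph on $n$ vertices is edge-regular with parameters $(n,k,\lambda)$ if every two adjacent vertices have exactly $\lambda$ common neighbours. A clique $C$ is regular with nexus $a$ (here $a\ge1$) if every vertex outside $C$ is adjacent to exactly $a$ vertices of $C$. A Neumaier graph is a non-complete edge-regular graph with a regular clique. A strongly regular Neumaier graph with parameters $(n,k,\lambda,\mu;a,c)$ is a Neumaier graph which is strongly regular with parameters $(n,k,\lambda,\mu)$ (adjacent vertices have $\lambda$, distinct non-adjacent vertices $\mu$ common neighbours) and has a regular clique of size $c$ with nexus $a$. -}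

module Defs where

open import Data.Nat using (ℕ; zero; suc; _≥_)
open import Data.Bool using (Bool; true; false; if_then_else_; _∧_)
open import Data.Fin using (Fin; zero; suc)
open import Data.Product using (Σ; ∃; _×_; _,_)
open import Data.Integer using (ℤ)
open import Data.Rational using (ℚ; 0ℚ; 1ℚ; _+_; _*_; _-_; _/_)
open import Relation.Binary.PropositionalEquality using (_≡_; _≢_)
open import Relation.Nullary using (¬_)

count : {n : ℕ} → (Fin n → Bool) → ℕ
count {zero} f = 0
count {suc n} f = (if f zero then 1 else 0) Data.Nat.+ count (λ i → f (suc i))

record Graph (n : ℕ) : Set where
  field
    adj     : Fin n → Fin n → Bool
    adj-sym : ∀ x y → adj x y ≡ adj y x
    irrefl  : ∀ x → adj x x ≡ false
open Graph public

common : {n : ℕ} → Graph n → Fin n → Fin n → ℕ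
common G x y = count (λ z → adj G x z ∧ adj G y z)

IsRegular : {n : ℕ} → Graph n → ℕ → Set
IsRegular G k = ∀ x → count (adj G x) ≡ k

IsNonComplete : {n : ℕ} → Graph n → Set
IsNonComplete G = Σ _ λ x → Σ _ λ y → x ≢ y × adj G x y ≡ false

IsStronglyRegular : (n k l m : ℕ) → Graph n → Set
IsStronglyRegular n k l m G =
  IsRegular G k
  × (∀ x y → adj G x y ≡ true → common G x y ≡ l)
  × (∀ x y → x ≢ y → adj G x y ≡ false → common G x y ≡ m)

IsClique : {n : ℕ} → Graph n → (Fin n → Bool) → Set
IsClique G C = ∀ x y → C x ≡ true → C y ≡ true → x ≢ y → adj G x y ≡ true

IsRegularClique : {n : ℕ} → Graph n → (Fin n → Bool) → (a c : ℕ) → Set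
IsRegularClique G C a c =
  IsClique G C × count C ≡ c × a ≥ 1
  × (∀ x → C x ≡ false → count (λ y → C y ∧ adj G x y) ≡ a)

IsSRNG : (n k l m a c : ℕ) → Graph n → Set
IsSRNG n k l m a c G =
  IsStronglyRegular n k l m G × IsNonComplete G
  × Σ (Fin n → Bool) (λ C → IsRegularClique G C a c)

sumℚ : {n : ℕ} → (Fin n → ℚ) → ℚ
sumℚ {zero} f = 0ℚ
sumℚ {suc n} f = f zero + sumℚ (λ i → f (suc i))

ℤtoℚ : ℤ → ℚ
ℤtoℚ z = z / 1

A : {n : ℕ} → Graph n → Fin n → Fin n → ℚ
A G x y = if adj G x y then 1ℚ else 0ℚ

Amul : {n : ℕ} → Graph n → (Fin n → ℚ) → Fin n → ℚ
Amul G v x = sumℚ (λ y → A G x y * v y)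

shift : {n : ℕ} → Graph n → ℚ → (Fin n → ℚ) → Fin n → ℚ
shift G θ v x = Amul G v x - θ * v x

IsEigenvalue : {n : ℕ} → Graph n → ℚ → Set
IsEigenvalue G θ = Σ _ λ (v : Fin _ → ℚ) →
  (∃ λ x → v x ≢ 0ℚ) × (∀ x → Amul G v x ≡ θ * v x)

module Submission where

-- Write A for the adjacency matrix, 𝟏 for the all-ones vector and J for the all-ones matrix.
-- Strong regularity says A² = (k − μ)I + (λ − μ)A + μJ, so (A − r)(A − s) = μJ whenever
-- r + s = λ − μ and rs = μ − k, and then (A − k)(A − r)(A − s) = 0 because AJ = kJ.
-- Take r = c − a − 1 and s = λ − μ − r. The indicator χ of the regular clique satisfies
-- Aχ = rχ + a𝟏; expanding A²χ both ways at a vertex outside and at a vertex inside the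
-- clique gives rs = μ − k and (c − a)(as + μ) = 0, and non-completeness forces c ≠ a,
-- so as = −μ. The eigenvectors are 𝟏 for k, (k − r)χ − a𝟏 for r, and (A − r)(e_z − e_w)
-- for s, where z lies outside the clique and w is a clique neighbour of z.

-- Kept in its own module so that its ℚ operators do not clash with the ℤ ones of the statement.
module NeumaierGraphs where

  open import Defs
  open import Algebra.Bundles using (CommutativeRing)
  open import Data.Bool using (Bool; true; false; if_then_else_; _∧_; not)
  open import Data.Bool.Properties using (∧-idem; ∧-identityʳ; ∧-comm; ∧-conicalˡ; ∧-conicalʳ; not-injective)
  open import Data.Fin using (Fin; zero; suc; _≟_)
  open import Data.Integer as ℤ using (ℤ; +0; +[1+_]; -[1+_])
  import Data.Integer.Properties as ℤ
  open import Data.Nat as ℕ using (ℕ; zero; suc)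
  import Data.Nat.Properties as ℕ
  open import Data.Nat.Coprimality using (1-coprimeTo) renaming (sym to coprime-sym)
  open import Data.Product using (∃; _×_; _,_; proj₁; proj₂)
  open import Data.Rational as ℚ using (ℚ; 0ℚ; 1ℚ; mkℚ; ↥_; _+_; _*_; _-_; -_; 1/_; ≢-nonZero)
  open import Data.Rational.Properties as ℚ
    using (+-*-commutativeRing; +-0-group; ↥p/↧p≡p; *-inverseˡ)
  open import Algebra.Properties.Group +-0-group using (x∙y⁻¹≈ε⇒x≈y; x≈y⇒x∙y⁻¹≈ε; inverseˡ-unique)
  open import Data.Sum as Sum using (_⊎_; inj₁; inj₂)
  open import Function using (_∘_; _⇔_; mk⇔)
  open import Level using (0ℓ)
  open import Relation.Binary.PropositionalEquality
  open import Relation.Nullary using (yes; no; contradiction)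
  open import Relation.Nullary.Decidable using (does; dec⇒maybe; dec-true; dec-false)
  open import Tactic.RingSolver using (solve-∀)
  open import Tactic.RingSolver.Core.AlmostCommutativeRing
    using (AlmostCommutativeRing; fromCommutativeRing)
  open import Algebra.Properties.CommutativeSemigroup
    (CommutativeRing.*-commutativeSemigroup +-*-commutativeRing) using (x∙yz≈y∙xz)
  open import Algebra.Properties.Semiring.Sum (CommutativeRing.semiring +-*-commutativeRing)
    using (sum; sum-syntax; sum-cong-≗; ∑-distrib-+; ∑-comm; *-distribˡ-sum; *-distribʳ-sum; sum-replicate-zero)

  ℚ-ring : AlmostCommutativeRing 0ℓ 0ℓ
  ℚ-ring = fromCommutativeRing +-*-commutativeRing (λ x → dec⇒maybe (0ℚ ℚ.≟ x))

  ℤtoℚ-mkℚ : ∀ z → ℤtoℚ z ≡ mkℚ z 0 (coprime-sym (1-coprimeTo _))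
  ℤtoℚ-mkℚ z = ↥p/↧p≡p (mkℚ z 0 (coprime-sym (1-coprimeTo _)))

  ℤtoℚ-injective : ∀ {x y} → ℤtoℚ x ≡ ℤtoℚ y → x ≡ y
  ℤtoℚ-injective {x} {y} eq = cong ↥_ (trans (sym (ℤtoℚ-mkℚ x)) (trans eq (ℤtoℚ-mkℚ y)))

  ℤtoℚ-+ : ∀ x y → ℤtoℚ (x ℤ.+ y) ≡ ℤtoℚ x + ℤtoℚ y
  ℤtoℚ-+ x y rewrite ℤtoℚ-mkℚ x | ℤtoℚ-mkℚ y =
    cong ℤtoℚ (sym (cong₂ ℤ._+_ (ℤ.*-identityʳ x) (ℤ.*-identityʳ y)))

  ℤtoℚ-* : ∀ x y → ℤtoℚ (x ℤ.* y) ≡ ℤtoℚ x * ℤtoℚ y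
  ℤtoℚ-* x y rewrite ℤtoℚ-mkℚ x | ℤtoℚ-mkℚ y = refl

  ℤtoℚ-neg : ∀ x → ℤtoℚ (ℤ.- x) ≡ - ℤtoℚ x
  ℤtoℚ-neg x rewrite ℤtoℚ-mkℚ x | ℤtoℚ-mkℚ (ℤ.- x) with x
  ... | +0       = refl
  ... | +[1+ _ ] = refl
  ... | -[1+ _ ] = refl

  ℤtoℚ-- : ∀ x y → ℤtoℚ (x ℤ.- y) ≡ ℤtoℚ x - ℤtoℚ y
  ℤtoℚ-- x y = trans (ℤtoℚ-+ x (ℤ.- y)) (cong (_+_ (ℤtoℚ x)) (ℤtoℚ-neg y))

  ℕtoℚ : ℕ → ℚ
  ℕtoℚ n = ℤtoℚ (ℤ.+ n)

  ℕtoℚ-injective : ∀ {m n} → ℕtoℚ m ≡ ℕtoℚ n → m ≡ n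
  ℕtoℚ-injective = ℤ.+-injective ∘ ℤtoℚ-injective

  ℕtoℚ-suc : ∀ n → ℕtoℚ (suc n) ≡ 1ℚ + ℕtoℚ n
  ℕtoℚ-suc n = ℤtoℚ-+ (ℤ.+ 1) (ℤ.+ n)

  p-q≡0⇒p≡q : ∀ {p q} → p - q ≡ 0ℚ → p ≡ q
  p-q≡0⇒p≡q = x∙y⁻¹≈ε⇒x≈y _ _

  p≡q⇒p-q≡0 : ∀ {p q} → p ≡ q → p - q ≡ 0ℚ
  p≡q⇒p-q≡0 = x≈y⇒x∙y⁻¹≈ε

  *-cancelˡ-≡0 : ∀ {p q} → p ≢ 0ℚ → p * q ≡ 0ℚ → q ≡ 0ℚ
  *-cancelˡ-≡0 {p} {q} p≢0 pq≡0 = begin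
    q                ≡⟨ ℚ.*-identityˡ q ⟨
    1ℚ * q           ≡⟨ cong (_* q) (*-inverseˡ p) ⟨
    (1/ p * p) * q   ≡⟨ ℚ.*-assoc (1/ p) p q ⟩
    1/ p * (p * q)   ≡⟨ cong (1/ p *_) pq≡0 ⟩
    1/ p * 0ℚ        ≡⟨ ℚ.*-zeroʳ (1/ p) ⟩
    0ℚ               ∎
    where open ≡-Reasoning; instance _ = ≢-nonZero p≢0

  *≡0⇒≡0⊎≡0 : ∀ p q → p * q ≡ 0ℚ → p ≡ 0ℚ ⊎ q ≡ 0ℚ
  *≡0⇒≡0⊎≡0 p q pq≡0 with p ℚ.≟ 0ℚ
  ... | yes p≡0 = inj₁ p≡0
  ... | no  p≢0 = inj₂ (*-cancelˡ-≡0 p≢0 pq≡0)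

  𝟙 : Bool → ℚ
  𝟙 b = if b then 1ℚ else 0ℚ

  𝟙-∧ : ∀ a b → 𝟙 a * 𝟙 b ≡ 𝟙 (a ∧ b)
  𝟙-∧ true  true  = refl
  𝟙-∧ true  false = refl
  𝟙-∧ false true  = refl
  𝟙-∧ false false = refl

  -- Uses does rather than ⌊_⌋ (= isYes), so that δ (suc x) (suc y) reduces to δ x y.
  δ : ∀ {n} → Fin n → Fin n → ℚ
  δ x y = 𝟙 (does (x ≟ y))

  count-cong : ∀ {n} {f g : Fin n → Bool} → (∀ i → f i ≡ g i) → count f ≡ count g
  count-cong {zero}  f≗g = refl
  count-cong {suc n} f≗g rewrite f≗g zero = cong (_ ℕ.+_) (count-cong (f≗g ∘ suc))

  count-split : ∀ {n} (f g : Fin n → Bool) →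
    count f ≡ count (λ i → f i ∧ g i) ℕ.+ count (λ i → f i ∧ not (g i))
  count-split {zero}  f g = refl
  count-split {suc n} f g with f zero | g zero | count-split (f ∘ suc) (g ∘ suc)
  ... | true  | true  | ih = cong suc ih
  ... | true  | false | ih = trans (cong suc ih) (sym (ℕ.+-suc _ _))
  ... | false | _     | ih = ih

  count-singleton : ∀ {n} (y : Fin n) → count (λ i → does (i ≟ y)) ≡ 1
  count-singleton {suc n} zero    = cong suc (count-false n)
    where
    count-false : ∀ n → count {n} (λ _ → false) ≡ 0
    count-false zero    = refl
    count-false (suc n) = count-false n
  count-singleton {suc n} (suc y) = count-singleton y

  count≡0⇒false : ∀ {n} (f : Fin n → Bool) → count f ≡ 0 → ∀ y → f y ≡ false
  count≡0⇒false {suc n} f eq y with f zero in f0 | y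
  ... | false | zero   = f0
  ... | false | suc y′ = count≡0⇒false (f ∘ suc) eq y′

  count≡1⇒unique : ∀ {n} (f : Fin n → Bool) → count f ≡ 1 →
    ∀ {x y} → f x ≡ true → f y ≡ true → x ≡ y
  count≡1⇒unique {suc n} f eq {x} {y} fx fy with f zero in f0 | x | y
  ... | true  | zero   | zero   = refl
  ... | true  | suc x′ | _      =
    contradiction (trans (sym fx) (count≡0⇒false (f ∘ suc) (ℕ.suc-injective eq) x′)) λ ()
  ... | true  | zero   | suc y′ =
    contradiction (trans (sym fy) (count≡0⇒false (f ∘ suc) (ℕ.suc-injective eq) y′)) λ ()
  ... | false | zero   | _      = contradiction (trans (sym fx) f0) λ ()
  ... | false | suc _  | zero   = contradiction (trans (sym fy) f0) λ ()
  ... | false | suc x′ | suc y′ = cong suc (count≡1⇒unique (f ∘ suc) eq fx fy)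

  count>0⇒∃ : ∀ {n} (f : Fin n → Bool) → 0 ℕ.< count f → ∃ λ y → f y ≡ true
  count>0⇒∃ {suc n} f pos with f zero in f0
  ... | true  = zero , f0
  ... | false = let y , fy = count>0⇒∃ (f ∘ suc) pos in suc y , fy

  *³≡0⇒≡0 : ∀ {p q r t} → p * (q * (r * t)) ≡ 0ℚ → t ≢ 0ℚ → p ≡ 0ℚ ⊎ q ≡ 0ℚ ⊎ r ≡ 0ℚ
  *³≡0⇒≡0 {p} {q} {r} {t} pqrt≡0 t≢0 with *≡0⇒≡0⊎≡0 p _ pqrt≡0
  ... | inj₁ p≡0 = inj₁ p≡0
  ... | inj₂ qrt≡0 with *≡0⇒≡0⊎≡0 q _ qrt≡0
  ... | inj₁ q≡0 = inj₂ (inj₁ q≡0)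
  ... | inj₂ rt≡0 = inj₂ (inj₂ (*-cancelˡ-≡0 t≢0 (trans (ℚ.*-comm t r) rt≡0)))

  sum-- : ∀ {n} (f g : Fin n → ℚ) → ∑[ i < n ] (f i - g i) ≡ sum f - sum g
  sum-- {zero}  f g = refl
  sum-- {suc n} f g = trans (cong (_+_ (f zero - g zero)) (sum-- (f ∘ suc) (g ∘ suc)))
    (interchange (f zero) (g zero) (sum (f ∘ suc)) (sum (g ∘ suc)))
    where
    interchange : ∀ a b c d → a - b + (c - d) ≡ a + c - (b + d)
    interchange = solve-∀ ℚ-ring

  sumℚ≡sum : ∀ {n} (f : Fin n → ℚ) → sumℚ f ≡ sum f
  sumℚ≡sum {zero}  f = refl
  sumℚ≡sum {suc n} f = cong (_+_ (f zero)) (sumℚ≡sum (f ∘ suc))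

  sum-𝟙 : ∀ {n} (b : Fin n → Bool) → ∑[ i < n ] 𝟙 (b i) ≡ ℕtoℚ (count b)
  sum-𝟙 {zero}  b = refl
  sum-𝟙 {suc n} b with b zero
  ... | true  = trans (cong (_+_ 1ℚ) (sum-𝟙 (b ∘ suc))) (sym (ℕtoℚ-suc (count (b ∘ suc))))
  ... | false = trans (ℚ.+-identityˡ _) (sum-𝟙 (b ∘ suc))

  sum-δ : ∀ {n} (f : Fin n → ℚ) (p : Fin n) → ∑[ y < n ] (f y * δ p y) ≡ f p
  sum-δ {suc n} f zero = begin
    f zero * 1ℚ + ∑[ y < n ] (f (suc y) * 0ℚ)
      ≡⟨ cong₂ _+_ (ℚ.*-identityʳ (f zero)) (sum-cong-≗ {n} (ℚ.*-zeroʳ ∘ f ∘ suc)) ⟩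
    f zero + ∑[ y < n ] 0ℚ                      ≡⟨ cong (_+_ (f zero)) (sum-replicate-zero n) ⟩
    f zero + 0ℚ                                 ≡⟨ ℚ.+-identityʳ _ ⟩
    f zero                                      ∎
    where open ≡-Reasoning
  sum-δ {suc n} f (suc p) = begin
    f zero * 0ℚ + ∑[ y < n ] (f (suc y) * δ p y)
      ≡⟨ cong (_+ ∑[ y < n ] (f (suc y) * δ p y)) (ℚ.*-zeroʳ (f zero)) ⟩
    0ℚ + ∑[ y < n ] (f (suc y) * δ p y)           ≡⟨ ℚ.+-identityˡ _ ⟩
    ∑[ y < n ] (f (suc y) * δ p y)               ≡⟨ sum-δ (f ∘ suc) p ⟩
    f (suc p)                                     ∎
    where open ≡-Reasoning

  sum-δ≡1 : ∀ {n} (p : Fin n) → sum (δ p) ≡ 1ℚ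
  sum-δ≡1 {n} p = trans (sum-cong-≗ {n} (λ y → sym (ℚ.*-identityˡ (δ p y)))) (sum-δ (λ _ → 1ℚ) p)

  module _ {n : ℕ} (G : Graph n) where

    Amul-sum : ∀ v x → Amul G v x ≡ ∑[ y < n ] (A G x y * v y)
    Amul-sum v x = sumℚ≡sum {n} _

    Amul-cong : ∀ {u v} → (∀ y → u y ≡ v y) → ∀ x → Amul G u x ≡ Amul G v x
    Amul-cong {u} {v} u≗v x = begin
      Amul G u x                   ≡⟨ Amul-sum u x ⟩
      ∑[ y < n ] (A G x y * u y)   ≡⟨ sum-cong-≗ {n} (λ y → cong (A G x y *_) (u≗v y)) ⟩
      ∑[ y < n ] (A G x y * v y)   ≡⟨ Amul-sum v x ⟨
      Amul G v x                   ∎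
      where open ≡-Reasoning

    Amul-+ : ∀ u v x → Amul G (λ y → u y + v y) x ≡ Amul G u x + Amul G v x
    Amul-+ u v x = begin
      Amul G (λ y → u y + v y) x                              ≡⟨ Amul-sum _ x ⟩
      ∑[ y < n ] (A G x y * (u y + v y))
        ≡⟨ sum-cong-≗ {n} (λ y → ℚ.*-distribˡ-+ (A G x y) (u y) (v y)) ⟩
      ∑[ y < n ] (A G x y * u y + A G x y * v y)              ≡⟨ ∑-distrib-+ {n} _ _ ⟩
      ∑[ y < n ] (A G x y * u y) + ∑[ y < n ] (A G x y * v y) ≡⟨ cong₂ _+_ (Amul-sum u x) (Amul-sum v x) ⟨
      Amul G u x + Amul G v x                                 ∎
      where open ≡-Reasoning

    Amul-* : ∀ α v x → Amul G (λ y → α * v y) x ≡ α * Amul G v x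
    Amul-* α v x = begin
      Amul G (λ y → α * v y) x              ≡⟨ Amul-sum _ x ⟩
      ∑[ y < n ] (A G x y * (α * v y))      ≡⟨ sum-cong-≗ {n} (λ y → x∙yz≈y∙xz (A G x y) α (v y)) ⟩
      ∑[ y < n ] (α * (A G x y * v y))      ≡⟨ *-distribˡ-sum {n} α _ ⟨
      α * ∑[ y < n ] (A G x y * v y)        ≡⟨ cong (α *_) (Amul-sum v x) ⟨
      α * Amul G v x                        ∎
      where open ≡-Reasoning

    Amul-𝟙 : ∀ (C : Fin n → Bool) x → Amul G (𝟙 ∘ C) x ≡ ℕtoℚ (count (λ y → adj G x y ∧ C y))
    Amul-𝟙 C x = begin
      Amul G (𝟙 ∘ C) x                      ≡⟨ Amul-sum _ x ⟩
      ∑[ y < n ] (A G x y * 𝟙 (C y))        ≡⟨ sum-cong-≗ {n} (λ y → 𝟙-∧ (adj G x y) (C y)) ⟩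
      ∑[ y < n ] 𝟙 (adj G x y ∧ C y)        ≡⟨ sum-𝟙 {n} _ ⟩
      ℕtoℚ (count (λ y → adj G x y ∧ C y))  ∎
      where open ≡-Reasoning

    Amul-Amul : ∀ v x → Amul G (Amul G v) x ≡ ∑[ z < n ] (ℕtoℚ (common G x z) * v z)
    Amul-Amul v x = begin
      Amul G (Amul G v) x
        ≡⟨ Amul-sum _ x ⟩
      ∑[ y < n ] (A G x y * Amul G v y)
        ≡⟨ sum-cong-≗ {n} (λ y → cong (A G x y *_) (Amul-sum v y)) ⟩
      ∑[ y < n ] (A G x y * ∑[ z < n ] (A G y z * v z))
        ≡⟨ sum-cong-≗ {n} (λ y → *-distribˡ-sum {n} (A G x y) _) ⟩
      ∑[ y < n ] ∑[ z < n ] (A G x y * (A G y z * v z))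
        ≡⟨ ∑-comm {n} {n} _ ⟩
      ∑[ z < n ] ∑[ y < n ] (A G x y * (A G y z * v z))
        ≡⟨ sum-cong-≗ {n} (λ z → sum-cong-≗ {n} (λ y → sym (ℚ.*-assoc (A G x y) (A G y z) (v z)))) ⟩
      ∑[ z < n ] ∑[ y < n ] (A G x y * A G y z * v z)
        ≡⟨ sum-cong-≗ {n} (λ z → *-distribʳ-sum {n} (v z) _) ⟨
      ∑[ z < n ] (∑[ y < n ] (A G x y * A G y z) * v z)
        ≡⟨ sum-cong-≗ {n} (λ z → cong (_* v z) (common-count z)) ⟩
      ∑[ z < n ] (ℕtoℚ (common G x z) * v z)
        ∎
      where
      open ≡-Reasoning
      common-count : ∀ z → ∑[ y < n ] (A G x y * A G y z) ≡ ℕtoℚ (common G x z)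
      common-count z = trans (sum-cong-≗ {n} λ y → trans (cong (λ b → A G x y * 𝟙 b) (adj-sym G y z))
                                                         (𝟙-∧ (adj G x y) (adj G z y)))
                             (sum-𝟙 {n} _)

    EigenEquation : ℚ → (Fin n → ℚ) → Set
    EigenEquation θ v = ∀ x → Amul G v x ≡ θ * v x

    Amul-- : ∀ u v x → Amul G (λ y → u y - v y) x ≡ Amul G u x - Amul G v x
    Amul-- u v x = begin
      Amul G (λ y → u y + - v y) x              ≡⟨ Amul-+ u _ x ⟩
      Amul G u x + Amul G (λ y → - v y) x       ≡⟨ cong (_+_ (Amul G u x)) (Amul-cong (λ y → negate (v y)) x) ⟩
      Amul G u x + Amul G (λ y → - 1ℚ * v y) x  ≡⟨ cong (_+_ (Amul G u x)) (Amul-* (- 1ℚ) v x) ⟩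
      Amul G u x + - 1ℚ * Amul G v x            ≡⟨ cong (_+_ (Amul G u x)) (negate (Amul G v x)) ⟨
      Amul G u x - Amul G v x                   ∎
      where
      open ≡-Reasoning
      negate : ∀ w → - w ≡ - 1ℚ * w
      negate w = trans (cong -_ (sym (ℚ.*-identityˡ w))) (ℚ.neg-distribˡ-* 1ℚ w)

    Amul-shift : ∀ β v x → Amul G (shift G β v) x ≡ Amul G (Amul G v) x - β * Amul G v x
    Amul-shift β v x = trans (Amul-- (Amul G v) _ x) (cong (_-_ (Amul G (Amul G v) x)) (Amul-* β v x))

    Amul-δ : ∀ p x → Amul G (δ p) x ≡ A G x p
    Amul-δ p x = trans (Amul-sum (δ p) x) (sum-δ (A G x) p)

    Amul-const : ∀ {k} → IsRegular G k → ∀ α x → Amul G (λ _ → α) x ≡ α * ℕtoℚ k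
    Amul-const {k} reg α x = begin
      Amul G (λ _ → α) x                          ≡⟨ Amul-cong (λ _ → ℚ.*-identityʳ α) x ⟨
      Amul G (λ _ → α * 𝟙 true) x                 ≡⟨ Amul-* α (λ _ → 1ℚ) x ⟩
      α * Amul G (𝟙 ∘ λ _ → true) x               ≡⟨ cong (α *_) (Amul-𝟙 (λ _ → true) x) ⟩
      α * ℕtoℚ (count (λ y → adj G x y ∧ true))
        ≡⟨ cong (λ d → α * ℕtoℚ d) (trans (count-cong (∧-identityʳ ∘ adj G x)) (reg x)) ⟩
      α * ℕtoℚ k                                  ∎
      where open ≡-Reasoning

    shift-eigen : ∀ θ {v} → EigenEquation θ v → ∀ β x → shift G β v x ≡ (θ - β) * v x
    shift-eigen θ {v} eig β x = trans (cong (_- β * v x) (eig x)) (factor θ β (v x))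
      where
      factor : ∀ θ β w → θ * w - β * w ≡ (θ - β) * w
      factor = solve-∀ ℚ-ring

    shift-preserves-eigen : ∀ θ {v} → EigenEquation θ v → ∀ β → EigenEquation θ (shift G β v)
    shift-preserves-eigen θ {v} eig β x = begin
      Amul G (shift G β v) x            ≡⟨ Amul-cong (shift-eigen θ eig β) x ⟩
      Amul G (λ y → (θ - β) * v y) x    ≡⟨ Amul-* (θ - β) v x ⟩
      (θ - β) * Amul G v x              ≡⟨ cong ((θ - β) *_) (eig x) ⟩
      (θ - β) * (θ * v x)               ≡⟨ x∙yz≈y∙xz (θ - β) θ (v x) ⟩
      θ * ((θ - β) * v x)               ≡⟨ cong (θ *_) (shift-eigen θ eig β x) ⟨
      θ * shift G β v x                 ∎
      where open ≡-Reasoning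

    shift³-eigen : ∀ θ {v} → EigenEquation θ v → ∀ κ₁ κ₂ κ₃ x →
      shift G κ₁ (shift G κ₂ (shift G κ₃ v)) x ≡ (θ - κ₁) * ((θ - κ₂) * ((θ - κ₃) * v x))
    shift³-eigen θ {v} eig κ₁ κ₂ κ₃ x = begin
      shift G κ₁ (shift G κ₂ (shift G κ₃ v)) x   ≡⟨ shift-eigen θ eig₂ κ₁ x ⟩
      (θ - κ₁) * shift G κ₂ (shift G κ₃ v) x     ≡⟨ cong ((θ - κ₁) *_) (shift-eigen θ eig₃ κ₂ x) ⟩
      (θ - κ₁) * ((θ - κ₂) * shift G κ₃ v x)
        ≡⟨ cong (λ w → (θ - κ₁) * ((θ - κ₂) * w)) (shift-eigen θ eig κ₃ x) ⟩
      (θ - κ₁) * ((θ - κ₂) * ((θ - κ₃) * v x))   ∎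
      where
      open ≡-Reasoning
      eig₃ : EigenEquation θ (shift G κ₃ v)
      eig₃ = shift-preserves-eigen θ eig κ₃
      eig₂ : EigenEquation θ (shift G κ₂ (shift G κ₃ v))
      eig₂ = shift-preserves-eigen θ eig₃ κ₂

    eigenvalue-root : ∀ {κ₁ κ₂ κ₃} → (∀ v x → shift G κ₁ (shift G κ₂ (shift G κ₃ v)) x ≡ 0ℚ) →
      ∀ {θ v x} → EigenEquation θ v → v x ≢ 0ℚ → θ ≡ κ₁ ⊎ θ ≡ κ₂ ⊎ θ ≡ κ₃
    eigenvalue-root {κ₁} {κ₂} {κ₃} annihilates {θ} {v} {x} eig vx≢0 =
      Sum.map p-q≡0⇒p≡q (Sum.map p-q≡0⇒p≡q p-q≡0⇒p≡q)
        (*³≡0⇒≡0 (trans (sym (shift³-eigen θ eig κ₁ κ₂ κ₃ x)) (annihilates v x)) vx≢0)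

    count-non-adjacent-regular : ∀ {k} → IsRegular G k → ∀ x y →
      count (not ∘ adj G x) ≡ count (not ∘ adj G y)
    count-non-adjacent-regular {k} reg x y = ℕ.+-cancelˡ-≡ k _ _ (trans (sym (vertices x)) (vertices y))
      where
      vertices : ∀ x → count {n} (λ _ → true) ≡ k ℕ.+ count (not ∘ adj G x)
      vertices x = trans (count-split (λ _ → true) (adj G x)) (cong (ℕ._+ _) (reg x))

  module StronglyRegular {n k l m : ℕ} {G : Graph n} (srg : IsStronglyRegular n k l m G) where

    private
      K L M : ℚ
      K = ℕtoℚ k
      L = ℕtoℚ l
      M = ℕtoℚ m

    common-srg : ∀ x z → ℕtoℚ (common G x z) ≡ (K - M) * δ x z + ((L - M) * A G x z + M)
    common-srg x z with x ≟ z
    ... | yes refl rewrite irrefl G x =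
      trans (cong ℕtoℚ (trans (count-cong (∧-idem ∘ adj G x)) (proj₁ srg x))) (sym (diagonal K L M))
      where
      diagonal : ∀ K L M → (K - M) * 1ℚ + ((L - M) * 0ℚ + M) ≡ K
      diagonal = solve-∀ ℚ-ring
    ... | no x≢z with adj G x z in x~z
    ...   | true  = trans (cong ℕtoℚ (proj₁ (proj₂ srg) x z x~z)) (sym (edge K L M))
      where
      edge : ∀ K L M → (K - M) * 0ℚ + ((L - M) * 1ℚ + M) ≡ L
      edge = solve-∀ ℚ-ring
    ...   | false = trans (cong ℕtoℚ (proj₂ (proj₂ srg) x z x≢z x~z)) (sym (non-edge K L M))
      where
      non-edge : ∀ K L M → (K - M) * 0ℚ + ((L - M) * 0ℚ + M) ≡ M
      non-edge = solve-∀ ℚ-ring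

    Amul²-srg : ∀ v x → Amul G (Amul G v) x ≡ (K - M) * v x + ((L - M) * Amul G v x + M * sum v)
    Amul²-srg v x = begin
      Amul G (Amul G v) x
        ≡⟨ Amul-Amul G v x ⟩
      ∑[ z < n ] (ℕtoℚ (common G x z) * v z)
        ≡⟨ sum-cong-≗ {n} (λ z → trans (cong (_* v z) (common-srg x z))
                                        (expand K L M (δ x z) (A G x z) (v z))) ⟩
      ∑[ z < n ] ((K - M) * (v z * δ x z) + ((L - M) * (A G x z * v z) + M * v z))
        ≡⟨ ∑-distrib-+ {n} _ _ ⟩
      ∑[ z < n ] ((K - M) * (v z * δ x z)) + ∑[ z < n ] ((L - M) * (A G x z * v z) + M * v z)
        ≡⟨ cong (_+_ (∑[ z < n ] ((K - M) * (v z * δ x z)))) (∑-distrib-+ {n} _ _) ⟩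
      ∑[ z < n ] ((K - M) * (v z * δ x z)) + (∑[ z < n ] ((L - M) * (A G x z * v z)) + ∑[ z < n ] (M * v z))
        ≡⟨ cong₂ _+_ (*-distribˡ-sum {n} (K - M) _)
                     (cong₂ _+_ (*-distribˡ-sum {n} (L - M) _) (*-distribˡ-sum {n} M v)) ⟨
      (K - M) * ∑[ z < n ] (v z * δ x z) + ((L - M) * ∑[ z < n ] (A G x z * v z) + M * sum v)
        ≡⟨ cong₂ (λ w u → (K - M) * w + ((L - M) * u + M * sum v)) (sum-δ v x) (sym (Amul-sum G v x)) ⟩
      (K - M) * v x + ((L - M) * Amul G v x + M * sum v)
        ∎
      where
      open ≡-Reasoning
      expand : ∀ K L M d a w →
        ((K - M) * d + ((L - M) * a + M)) * w ≡ (K - M) * (w * d) + ((L - M) * (a * w) + M * w)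
      expand = solve-∀ ℚ-ring

    shift²-srg : ∀ r s → r + s ≡ L - M → r * s ≡ M - K → ∀ v x → shift G r (shift G s v) x ≡ M * sum v
    shift²-srg r s r+s r*s v x = begin
      Amul G (shift G s v) x - r * shift G s v x
        ≡⟨ cong (_- r * shift G s v x) (trans (Amul-shift G s v x) (cong (_- s * Amul G v x) (Amul²-srg v x))) ⟩
      (K - M) * v x + ((L - M) * Amul G v x + M * sum v) - s * Amul G v x - r * (Amul G v x - s * v x)
        ≡⟨ collect K L M r s (v x) (Amul G v x) (sum v) ⟩
      (K - M + r * s) * v x + ((L - M - (r + s)) * Amul G v x + M * sum v)
        ≡⟨ cong₂ (λ p q → (K - M + p) * v x + ((L - M - q) * Amul G v x + M * sum v)) r*s r+s ⟩
      (K - M + (M - K)) * v x + ((L - M - (L - M)) * Amul G v x + M * sum v)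
        ≡⟨ cancel K L M (v x) (Amul G v x) (sum v) ⟩
      M * sum v
        ∎
      where
      open ≡-Reasoning
      collect : ∀ K L M r s V W σ → (K - M) * V + ((L - M) * W + M * σ) - s * W - r * (W - s * V)
                                    ≡ (K - M + r * s) * V + ((L - M - (r + s)) * W + M * σ)
      collect = solve-∀ ℚ-ring
      cancel : ∀ K L M V W σ → (K - M + (M - K)) * V + ((L - M - (L - M)) * W + M * σ) ≡ M * σ
      cancel = solve-∀ ℚ-ring

  module RegularClique {n a c : ℕ} {G : Graph n} {C : Fin n → Bool} (clique : IsRegularClique G C a c) where

    private
      is-clique : IsClique G C
      is-clique = proj₁ clique
      size : count C ≡ c
      size = proj₁ (proj₂ clique)
      nexus≥1 : a ℕ.≥ 1
      nexus≥1 = proj₁ (proj₂ (proj₂ clique))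
      nexus : ∀ x → C x ≡ false → count (λ y → C y ∧ adj G x y) ≡ a
      nexus = proj₂ (proj₂ (proj₂ clique))

    clique-degree : ∀ {y} → C y ≡ true → c ≡ suc (count (λ v → adj G y v ∧ C v))
    clique-degree {y} y∈C = begin
      c                                                            ≡⟨ size ⟨
      count C                                                      ≡⟨ count-split C (adj G y) ⟩
      count (λ v → C v ∧ adj G y v) ℕ.+ count (λ v → C v ∧ not (adj G y v))
        ≡⟨ cong₂ ℕ._+_ (count-cong (λ v → ∧-comm (C v) (adj G y v)))
                       (trans (count-cong only-y) (count-singleton y)) ⟩
      count (λ v → adj G y v ∧ C v) ℕ.+ 1                          ≡⟨ ℕ.+-comm _ 1 ⟩
      suc (count (λ v → adj G y v ∧ C v))                          ∎
      where
      open ≡-Reasoning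
      only-y : ∀ v → (C v ∧ not (adj G y v)) ≡ does (v ≟ y)
      only-y v with v ≟ y
      ... | yes refl rewrite y∈C | irrefl G y = refl
      ... | no v≢y with C v in v∈C
      ...   | true  rewrite is-clique y v y∈C v∈C (v≢y ∘ sym) = refl
      ...   | false = refl

    Amul-clique : ∀ y → Amul G (𝟙 ∘ C) y ≡ (ℕtoℚ c - ℕtoℚ a - 1ℚ) * 𝟙 (C y) + ℕtoℚ a
    Amul-clique y with C y in y∈C
    ... | false = begin
      Amul G (𝟙 ∘ C) y                               ≡⟨ Amul-𝟙 G C y ⟩
      ℕtoℚ (count (λ v → adj G y v ∧ C v))
        ≡⟨ cong ℕtoℚ (trans (count-cong (λ v → ∧-comm (adj G y v) (C v))) (nexus y y∈C)) ⟩
      ℕtoℚ a                                         ≡⟨ outside (ℕtoℚ c - ℕtoℚ a - 1ℚ) (ℕtoℚ a) ⟩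
      (ℕtoℚ c - ℕtoℚ a - 1ℚ) * 0ℚ + ℕtoℚ a           ∎
      where
      open ≡-Reasoning
      outside : ∀ R α → α ≡ R * 0ℚ + α
      outside = solve-∀ ℚ-ring
    ... | true = begin
      Amul G (𝟙 ∘ C) y                               ≡⟨ Amul-𝟙 G C y ⟩
      ℕtoℚ d                                         ≡⟨ inside (ℕtoℚ d) (ℕtoℚ a) ⟩
      (1ℚ + ℕtoℚ d - ℕtoℚ a - 1ℚ) * 1ℚ + ℕtoℚ a
        ≡⟨ cong (λ γ → (γ - ℕtoℚ a - 1ℚ) * 1ℚ + ℕtoℚ a)
                (trans (sym (ℕtoℚ-suc d)) (cong ℕtoℚ (sym (clique-degree y∈C)))) ⟩
      (ℕtoℚ c - ℕtoℚ a - 1ℚ) * 1ℚ + ℕtoℚ a           ∎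
      where
      open ≡-Reasoning
      d : ℕ
      d = count (λ v → adj G y v ∧ C v)
      inside : ∀ D α → D ≡ (1ℚ + D - α - 1ℚ) * 1ℚ + α
      inside = solve-∀ ℚ-ring

    vertex-outside-clique : IsNonComplete G → ∃ λ z → C z ≡ false
    vertex-outside-clique (x , y , x≢y , x≁y) with C x in x∈C | C y in y∈C
    ... | false | _     = x , x∈C
    ... | true  | false = y , y∈C
    ... | true  | true  = contradiction (trans (sym (is-clique x y x∈C y∈C x≢y)) x≁y) λ ()

    clique-neighbour : ∀ {z} → C z ≡ false → ∃ λ w → C w ≡ true × adj G z w ≡ true
    clique-neighbour {z} z∉C =
      let w , w∈C∧z~w = count>0⇒∃ (λ v → C v ∧ adj G z v) (subst (0 ℕ.<_) (sym (nexus z z∉C)) nexus≥1)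
      in w , ∧-conicalˡ _ _ w∈C∧z~w , ∧-conicalʳ _ _ w∈C∧z~w

    -- If c = a, every vertex outside C sees all of C, so a clique vertex w is adjacent to all
    -- other vertices; by regularity then so is every vertex, contradicting non-completeness.
    nexus≢size : ∀ {k} → IsRegular G k → IsNonComplete G → c ≢ a
    nexus≢size reg nc@(x , y , x≢y , x≁y) c≡a =
      x≢y (count≡1⇒unique (not ∘ adj G x) x-misses-one (cong not (irrefl G x)) (cong not x≁y))
      where
      z∉C : C (proj₁ (vertex-outside-clique nc)) ≡ false
      z∉C = proj₂ (vertex-outside-clique nc)
      w : Fin n
      w = proj₁ (clique-neighbour z∉C)
      w∈C : C w ≡ true
      w∈C = proj₁ (proj₂ (clique-neighbour z∉C))

      sees-whole-clique : ∀ {v} → C v ≡ false → ∀ {u} → C u ≡ true → adj G v u ≡ true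
      sees-whole-clique {v} v∉C {u} u∈C =
        not-injective (subst (λ b → (b ∧ not (adj G v u)) ≡ false) u∈C (count≡0⇒false _ misses-none u))
        where
        misses-none : count (λ u → C u ∧ not (adj G v u)) ≡ 0
        misses-none = ℕ.+-cancelˡ-≡ c _ 0 (begin
          c ℕ.+ count (λ u → C u ∧ not (adj G v u))
            ≡⟨ cong (ℕ._+ _) (trans c≡a (sym (nexus v v∉C))) ⟩
          count (λ u → C u ∧ adj G v u) ℕ.+ count (λ u → C u ∧ not (adj G v u))
            ≡⟨ count-split C (adj G v) ⟨
          count C
            ≡⟨ size ⟩
          c
            ≡⟨ ℕ.+-identityʳ c ⟨
          c ℕ.+ 0
            ∎)
          where open ≡-Reasoning

      w-misses-only-w : ∀ v → not (adj G w v) ≡ does (v ≟ w)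
      w-misses-only-w v with v ≟ w
      ... | yes refl rewrite irrefl G w = refl
      ... | no v≢w with C v in v∈C
      ...   | true  rewrite is-clique w v w∈C v∈C (v≢w ∘ sym) = refl
      ...   | false rewrite adj-sym G w v | sees-whole-clique v∈C w∈C = refl

      x-misses-one : count (not ∘ adj G x) ≡ 1
      x-misses-one = trans (count-non-adjacent-regular G reg x w)
                           (trans (count-cong w-misses-only-w) (count-singleton w))

  -- The two hypotheses are the two expansions of A(Aχ), for χ the indicator of a regular clique
  -- with Aχ = Rχ + α, evaluated at a vertex outside (χ = 0) and inside (χ = 1) the clique.
  srg-clique-relations : ∀ {K L M α γ R S : ℚ} → R ≡ γ - α - 1ℚ → S ≡ L - M - R → γ - α ≢ 0ℚ →
    R * (R * 0ℚ + α) + α * K ≡ (K - M) * 0ℚ + ((L - M) * (R * 0ℚ + α) + M * γ) →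
    R * (R * 1ℚ + α) + α * K ≡ (K - M) * 1ℚ + ((L - M) * (R * 1ℚ + α) + M * γ) →
    R * S ≡ M - K × S * α ≡ - M
  srg-clique-relations {K} {L} {M} {α} {γ} refl refl γ-α≢0 E₀ E₁ = RS≡M-K , Sα≡-M
    where
    R S : ℚ
    R = γ - α - 1ℚ
    S = L - M - R

    RS≡M-K : R * S ≡ M - K
    RS≡M-K = p-q≡0⇒p≡q (trans (identity K L M α γ) (cong₂ _-_ (p≡q⇒p-q≡0 E₀) (p≡q⇒p-q≡0 E₁)))
      where
      identity : ∀ K L M α γ → let R = γ - α - 1ℚ; S = L - M - R in
        R * S - (M - K) ≡
        (R * (R * 0ℚ + α) + α * K - ((K - M) * 0ℚ + ((L - M) * (R * 0ℚ + α) + M * γ)))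
        - (R * (R * 1ℚ + α) + α * K - ((K - M) * 1ℚ + ((L - M) * (R * 1ℚ + α) + M * γ)))
      identity = solve-∀ ℚ-ring

    Sα≡-M : S * α ≡ - M
    Sα≡-M = inverseˡ-unique (S * α) M (*-cancelˡ-≡0 γ-α≢0 (begin
      (γ - α) * (S * α + M)
        ≡⟨ identity K L M α γ ⟩
      α * (R * S - (M - K)) - (R * (R * 0ℚ + α) + α * K - ((K - M) * 0ℚ + ((L - M) * (R * 0ℚ + α) + M * γ)))
        ≡⟨ cong₂ (λ u v → α * u - v) (p≡q⇒p-q≡0 RS≡M-K) (p≡q⇒p-q≡0 E₀) ⟩
      α * 0ℚ - 0ℚ
        ≡⟨ cong (_- 0ℚ) (ℚ.*-zeroʳ α) ⟩
      0ℚ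
        ∎))
      where
      open ≡-Reasoning
      identity : ∀ K L M α γ → let R = γ - α - 1ℚ; S = L - M - R in
        (γ - α) * (S * α + M) ≡
        α * (R * S - (M - K)) - (R * (R * 0ℚ + α) + α * K - ((K - M) * 0ℚ + ((L - M) * (R * 0ℚ + α) + M * γ)))
      identity = solve-∀ ℚ-ring

  module Neumaier {n k l m a c : ℕ} {G : Graph n} (H : IsSRNG n k l m a c G) where

    private
      srg : IsStronglyRegular n k l m G
      srg = proj₁ H
      regular : IsRegular G k
      regular = proj₁ srg
      non-complete : IsNonComplete G
      non-complete = proj₁ (proj₂ H)
      C : Fin n → Bool
      C = proj₁ (proj₂ (proj₂ H))
      clique : IsRegularClique G C a c
      clique = proj₂ (proj₂ (proj₂ H))

    open StronglyRegular {n} {k} {l} {m} {G} srg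
    open RegularClique {n} {a} {c} {G} {C} clique

    r s : ℤ
    r = ℤ.+ c ℤ.- ℤ.+ a ℤ.- ℤ.+ 1
    s = ℤ.+ l ℤ.- ℤ.+ m ℤ.- r

    K L M α γ R S : ℚ
    K = ℕtoℚ k
    L = ℕtoℚ l
    M = ℕtoℚ m
    α = ℕtoℚ a
    γ = ℕtoℚ c
    R = ℤtoℚ r
    S = ℤtoℚ s

    R≡γ-α-1 : R ≡ γ - α - 1ℚ
    R≡γ-α-1 = trans (ℤtoℚ-- (ℤ.+ c ℤ.- ℤ.+ a) (ℤ.+ 1)) (cong (_- 1ℚ) (ℤtoℚ-- (ℤ.+ c) (ℤ.+ a)))

    S≡L-M-R : S ≡ L - M - R
    S≡L-M-R = trans (ℤtoℚ-- (ℤ.+ l ℤ.- ℤ.+ m) r) (cong (_- R) (ℤtoℚ-- (ℤ.+ l) (ℤ.+ m)))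

    χ : Fin n → ℚ
    χ = 𝟙 ∘ C

    Amul-χ : ∀ y → Amul G χ y ≡ R * χ y + α
    Amul-χ y = trans (Amul-clique y) (cong (λ ρ → ρ * χ y + α) (sym R≡γ-α-1))

    clique-equation : ∀ z {t} → χ z ≡ t →
      R * (R * t + α) + α * K ≡ (K - M) * t + ((L - M) * (R * t + α) + M * γ)
    clique-equation z refl = begin
      R * (R * χ z + α) + α * K
        ≡⟨ cong₂ (λ u w → R * u + w) (Amul-χ z) (Amul-const G regular α z) ⟨
      R * Amul G χ z + Amul G (λ _ → α) z
        ≡⟨ cong (_+ Amul G (λ _ → α) z) (Amul-* G R χ z) ⟨
      Amul G (λ y → R * χ y) z + Amul G (λ _ → α) z
        ≡⟨ Amul-+ G _ _ z ⟨
      Amul G (λ y → R * χ y + α) z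
        ≡⟨ Amul-cong G Amul-χ z ⟨
      Amul G (Amul G χ) z
        ≡⟨ Amul²-srg χ z ⟩
      (K - M) * χ z + ((L - M) * Amul G χ z + M * sum χ)
        ≡⟨ cong₂ (λ u σ → (K - M) * χ z + ((L - M) * u + M * σ))
                 (Amul-χ z) (trans (sum-𝟙 {n} C) (cong ℕtoℚ (proj₁ (proj₂ clique)))) ⟩
      (K - M) * χ z + ((L - M) * (R * χ z + α) + M * γ)
        ∎
      where open ≡-Reasoning

    private
      z₀ : Fin n
      z₀ = proj₁ (vertex-outside-clique non-complete)
      z₀∉C : C z₀ ≡ false
      z₀∉C = proj₂ (vertex-outside-clique non-complete)
      w : Fin n
      w = proj₁ (clique-neighbour z₀∉C)
      w∈C : C w ≡ true
      w∈C = proj₁ (proj₂ (clique-neighbour z₀∉C))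
      z₀~w : adj G z₀ w ≡ true
      z₀~w = proj₂ (proj₂ (clique-neighbour z₀∉C))

    γ-α≢0 : γ - α ≢ 0ℚ
    γ-α≢0 = nexus≢size regular non-complete ∘ ℕtoℚ-injective ∘ p-q≡0⇒p≡q

    α≢0 : α ≢ 0ℚ
    α≢0 α≡0 with ℕtoℚ-injective {a} {0} α≡0 | proj₁ (proj₂ (proj₂ clique))
    ... | refl | ()

    parameter-relations : R * S ≡ M - K × S * α ≡ - M
    parameter-relations = srg-clique-relations {K} {L} {M} {α} {γ} R≡γ-α-1 S≡L-M-R γ-α≢0
      (clique-equation z₀ (cong 𝟙 z₀∉C)) (clique-equation w (cong 𝟙 w∈C))

    RS≡M-K : R * S ≡ M - K
    RS≡M-K = proj₁ parameter-relations

    Sα≡-M : S * α ≡ - M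
    Sα≡-M = proj₂ parameter-relations

    sa≡-m : s ℤ.* ℤ.+ a ≡ ℤ.- ℤ.+ m
    sa≡-m = ℤtoℚ-injective (trans (ℤtoℚ-* s (ℤ.+ a)) (trans Sα≡-M (sym (ℤtoℚ-neg (ℤ.+ m)))))

    R+S≡L-M : R + S ≡ L - M
    R+S≡L-M = trans (cong (R +_) S≡L-M-R) (cancel R L M)
      where
      cancel : ∀ R L M → R + (L - M - R) ≡ L - M
      cancel = solve-∀ ℚ-ring

    annihilated : ∀ v x → shift G K (shift G R (shift G S v)) x ≡ 0ℚ
    annihilated v x = begin
      Amul G (shift G R (shift G S v)) x - K * shift G R (shift G S v) x
        ≡⟨ cong₂ (λ p q → p - K * q) (Amul-cong G (constant v) x) (constant v x) ⟩
      Amul G (λ _ → M * sum v) x - K * (M * sum v)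
        ≡⟨ cong (_- K * (M * sum v)) (Amul-const G regular (M * sum v) x) ⟩
      M * sum v * K - K * (M * sum v)
        ≡⟨ p≡q⇒p-q≡0 (ℚ.*-comm (M * sum v) K) ⟩
      0ℚ
        ∎
      where
      open ≡-Reasoning
      constant : ∀ v x → shift G R (shift G S v) x ≡ M * sum v
      constant = shift²-srg R S R+S≡L-M RS≡M-K

    K-eigenvalue : IsEigenvalue G K
    K-eigenvalue = (λ _ → 1ℚ) , (z₀ , λ ()) , λ x → trans (Amul-const G regular 1ℚ x) (ℚ.*-comm 1ℚ K)

    R-eigenvalue : IsEigenvalue G R
    R-eigenvalue = v , (z₀ , v[z₀]≢0) , eigen
      where
      v : Fin n → ℚ
      v y = (K - R) * χ y - α
      eigen : EigenEquation G R v
      eigen x = begin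
        Amul G v x                                     ≡⟨ Amul-- G _ _ x ⟩
        Amul G (λ y → (K - R) * χ y) x - Amul G (λ _ → α) x
          ≡⟨ cong₂ _-_ (trans (Amul-* G (K - R) χ x) (cong ((K - R) *_) (Amul-χ x))) (Amul-const G regular α x) ⟩
        (K - R) * (R * χ x + α) - α * K                ≡⟨ factor K R α (χ x) ⟩
        R * v x                                        ∎
        where
        open ≡-Reasoning
        factor : ∀ K R α t → (K - R) * (R * t + α) - α * K ≡ R * ((K - R) * t - α)
        factor = solve-∀ ℚ-ring
      v[z₀]≢0 : v z₀ ≢ 0ℚ
      v[z₀]≢0 v[z₀]≡0 = α≢0 (ℚ.neg-injective (begin
        - α                          ≡⟨ outside (K - R) α ⟩
        (K - R) * 0ℚ - α             ≡⟨ cong (λ t → (K - R) * 𝟙 t - α) z₀∉C ⟨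
        v z₀                         ≡⟨ v[z₀]≡0 ⟩
        - 0ℚ                         ∎))
        where
        open ≡-Reasoning
        outside : ∀ ρ α → - α ≡ ρ * 0ℚ - α
        outside = solve-∀ ℚ-ring

    -- e has zero sum, so (A − S)(A − R)e = μ (∑ e) 𝟏 = 0.
    S-eigenvalue : IsEigenvalue G S
    S-eigenvalue = u , (z₀ , u[z₀]≢0) , eigen
      where
      e u : Fin n → ℚ
      e y = δ z₀ y - δ w y
      u = shift G R e
      eigen : EigenEquation G S u
      eigen x = p-q≡0⇒p≡q (begin
        shift G S (shift G R e) x
          ≡⟨ shift²-srg S R (trans (ℚ.+-comm S R) R+S≡L-M) (trans (ℚ.*-comm S R) RS≡M-K) e x ⟩
        M * sum e
          ≡⟨ cong (M *_) (trans (sum-- (δ z₀) (δ w)) (cong₂ _-_ (sum-δ≡1 z₀) (sum-δ≡1 w))) ⟩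
        M * (1ℚ - 1ℚ)
          ≡⟨ ℚ.*-zeroʳ M ⟩
        0ℚ
          ∎)
        where open ≡-Reasoning
      w≢z₀ : w ≢ z₀
      w≢z₀ w≡z₀ = contradiction (trans (sym w∈C) (trans (cong C w≡z₀) z₀∉C)) λ ()
      u[z₀]≢0 : u z₀ ≢ 0ℚ
      u[z₀]≢0 u[z₀]≡0 = γ-α≢0 (ℚ.neg-injective (begin
        - (γ - α)
          ≡⟨ value γ α ⟩
        (0ℚ - 1ℚ) - (γ - α - 1ℚ) * (1ℚ - 0ℚ)
          ≡⟨ cong₂ (λ p q → p - q * (1ℚ - 0ℚ)) Ae[z₀] R≡γ-α-1 ⟨
        Amul G e z₀ - R * (1ℚ - 0ℚ)
          ≡⟨ cong (λ p → Amul G e z₀ - R * p) e[z₀] ⟨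
        u z₀
          ≡⟨ u[z₀]≡0 ⟩
        - 0ℚ
          ∎))
        where
        open ≡-Reasoning
        value : ∀ γ α → - (γ - α) ≡ (0ℚ - 1ℚ) - (γ - α - 1ℚ) * (1ℚ - 0ℚ)
        value = solve-∀ ℚ-ring
        e[z₀] : e z₀ ≡ 1ℚ - 0ℚ
        e[z₀] = cong₂ (λ p q → 𝟙 p - 𝟙 q) (dec-true (z₀ ≟ z₀) refl) (dec-false (w ≟ z₀) w≢z₀)
        Ae[z₀] : Amul G e z₀ ≡ 0ℚ - 1ℚ
        Ae[z₀] = trans (Amul-- G (δ z₀) (δ w) z₀)
          (cong₂ _-_ (trans (Amul-δ G z₀ z₀) (cong 𝟙 (irrefl G z₀)))
                     (trans (Amul-δ G w z₀) (cong 𝟙 z₀~w)))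

    spectrum : ∀ θ → IsEigenvalue G θ ⇔ (θ ≡ K ⊎ θ ≡ R ⊎ θ ≡ S)
    spectrum θ = mk⇔ root-if-eigenvalue eigenvalue-if-root
      where
      root-if-eigenvalue : IsEigenvalue G θ → θ ≡ K ⊎ θ ≡ R ⊎ θ ≡ S
      root-if-eigenvalue (v , (x , vx≢0) , eigen) = eigenvalue-root G annihilated {θ} {v} eigen vx≢0
      eigenvalue-if-root : θ ≡ K ⊎ θ ≡ R ⊎ θ ≡ S → IsEigenvalue G θ
      eigenvalue-if-root (inj₁ refl)        = K-eigenvalue
      eigenvalue-if-root (inj₂ (inj₁ refl)) = R-eigenvalue
      eigenvalue-if-root (inj₂ (inj₂ refl)) = S-eigenvalue

open import Defs
open import Data.Nat using (ℕ)
open import Data.Fin using (Fin)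
open import Data.Product using (Σ; _×_; _,_)
open import Data.Sum using (_⊎_)
open import Data.Integer using (ℤ; +_; -_; _-_; _*_)
open import Data.Rational using (ℚ; 0ℚ)
open import Function.Bundles using (_⇔_)
open import Relation.Binary.PropositionalEquality using (_≡_)

proposition3p7 : (n k l m a c : ℕ) (G : Graph n) → IsSRNG n k l m a c G →
    Σ ℤ λ s → (s * (+ a) ≡ - (+ m))
      × (∀ (θ : ℚ) → IsEigenvalue G θ ⇔
           (θ ≡ ℤtoℚ (+ k) ⊎ θ ≡ ℤtoℚ ((+ c) - (+ a) - (+ 1)) ⊎ θ ≡ ℤtoℚ s))
      × (∀ (v : Fin n → ℚ) (x : Fin n) →
           shift G (ℤtoℚ (+ k)) (shift G (ℤtoℚ ((+ c) - (+ a) - (+ 1))) (shift G (ℤtoℚ s) v)) x ≡ 0ℚ)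
proposition3p7 n k l m a c G H = s , sa≡-m , spectrum , annihilated
  where open NeumaierGraphs.Neumaier {n} {k} {l} {m} {a} {c} {G} H
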